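{- There does not exist any deeply critical oriented circulant clique of even order; that is, for no even $n$ and no admissible $S\subseteq\mathbb{Z}_n$ is the oriented circulant graph $\overrightarrow{C}(n,S)$ both an absolute oriented clique and deeply critical.
   Context: An oriented graph is a directed graph with no loops and no directed cycles of length two. An oriented $k$-colouring of $\overrightarrow{G}$ is a function $\phi:V(\overrightarrow{G})\to\{1,\dots,k\}$ such that (i) $\phi(x)\neq\phi(y)$ for every arc $xy$, and (ii) for all arcs $xy,uv$, if $\phi(x)=\phi(v)$ then $\phi(y)\neq\phi(u)$. The oriented chromatic number $\chi_o(\overrightarrow{G})$ is the least such $k$. An absolute oriented clique is an oriented graph with $\chi_o(\overrightarrow{G})=|V(\overrightarrow{G})|$. An oriented graph is deeply critical if $\chi_o(\overrightarrow{G}-xy)=\chi_o(\overrightarrow{G})-2$ for every arc $xy$. For an integer $n$ and $S\subseteq\mathbb{Z}_n$ such that for all $k\in\mathbb{Z}_n$, $k\in S$ implies $-k\notin S$ (admissible $S$), the oriented circulant graph $\overrightarrow{C}(n,S)$ has vertex set $\mathbb{Z}_n$ and an arc $ij$ whenever $j-i$ is congruent modulo $n$ to an element of $S$. -}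

module Defs where

open import Data.Nat using (ℕ; _+_; _∸_; _<_; NonZero)
open import Data.Nat.DivMod using (_mod_)
open import Data.Fin using (Fin; toℕ)
open import Data.Fin.Subset using (Subset; _∈_; _∉_)
open import Data.Product using (_×_; ∃)
open import Relation.Nullary using (¬_)
open import Relation.Binary.PropositionalEquality using (_≡_; _≢_)

Rel : ℕ → Set₁
Rel m = Fin m → Fin m → Set

IsOrientedColouring : ∀ {m} (A : Rel m) (k : ℕ) → (Fin m → Fin k) → Set
IsOrientedColouring {m} A k φ =
  (∀ x y → A x y → φ x ≢ φ y) ×
  (∀ x y u v → A x y → A u v → φ x ≡ φ v → φ y ≢ φ u)

HasOrientedColouring : ∀ {m} (A : Rel m) (k : ℕ) → Set
HasOrientedColouring {m} A k = ∃ λ (φ : Fin m → Fin k) → IsOrientedColouring A k φ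

ChiO : ∀ {m} (A : Rel m) (k : ℕ) → Set
ChiO A k = HasOrientedColouring A k × (∀ j → j < k → ¬ HasOrientedColouring A j)

deleteArc : ∀ {m} (A : Rel m) → Fin m → Fin m → Rel m
deleteArc A x y u v = A u v × ¬ (u ≡ x × v ≡ y)

IsAbsoluteClique : ∀ {m} (A : Rel m) → Set
IsAbsoluteClique {m} A = ChiO A m

IsDeeplyCritical : ∀ {m} (A : Rel m) → Set
IsDeeplyCritical A = ∀ k → ChiO A k → ∀ x y → A x y → ChiO (deleteArc A x y) (k ∸ 2)

diffZ : (n : ℕ) .{{_ : NonZero n}} → Fin n → Fin n → Fin n
diffZ n i j = (n + toℕ j ∸ toℕ i) mod n     -- j - i mod n

negZ : (n : ℕ) .{{_ : NonZero n}} → Fin n → Fin n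
negZ n k = (n ∸ toℕ k) mod n

Admissible : (n : ℕ) .{{_ : NonZero n}} → Subset n → Set
Admissible n S = ∀ k → k ∈ S → negZ n k ∉ S

Circulant : (n : ℕ) .{{_ : NonZero n}} → Subset n → Rel n
Circulant n S i j = diffZ n i j ∈ S

-- In ℤₙ with n even, h = n/2 is its own negative, so admissibility forbids the difference h and
-- the vertices 0 and h are non-adjacent. In an absolute clique two vertices that are neither
-- adjacent nor joined by a directed 2-path could share a colour, so there is a 2-path u → m → w
-- with w - u = h. Deleting mw leaves an (n-2)-colouring φ, and giving m a fresh colour yields an
-- (n-1)-colouring of the whole graph, unless an in-neighbour c of m has φ c = φ w. With
-- s = w - m and t = m - u, such a c gives a 2-path avoiding mw whose ends φ must colour
-- differently: c → c+s → w if c ≠ m - s, and w → w+t → c if c = m - s (as 2s + 2t = 2h = 0).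
module Submission where

open import Defs
open import Algebra.Bundles using (AbelianGroup)
open import Algebra.Structures using (IsAbelianGroup)
import Algebra.Properties.AbelianGroup as AbelianGroupProperties
import Algebra.Solver.CommutativeMonoid as CommutativeMonoidSolver
open import Data.Nat using (ℕ; zero; suc; _+_; _∸_; _*_; _%_; _≤_; _<_; NonZero; s≤s; z≤n)
open import Data.Nat.DivMod using (_mod_; %-distribˡ-+; m%n%n≡m%n; [m+n]%n≡m%n; m<n⇒m%n≡m; n%n≡0; m%n<n)
open import Data.Nat.Divisibility using (_∣_; divides; ∣1⇒≡1)
open import Data.Nat.Properties using (+-comm; +-assoc; +-identityʳ; *-comm; m+[n∸m]≡n; ≤-trans; ≤-refl; <⇒≤; m≤m+n; m<m*n)
open import Data.Fin using (Fin; zero; toℕ; fromℕ; fromℕ<; inject₁; punchOut)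
open import Data.Fin.Properties using (toℕ-injective; toℕ-fromℕ<; toℕ<n; fromℕ≢inject₁; inject₁-injective; punchOut-injective) renaming (_≟_ to _≟ᶠ_)
open import Data.Fin.Subset using (Subset; _∈_)
open import Data.Product using (_×_; _,_; proj₁; proj₂; ∃)
open import Data.Sum using (_⊎_; inj₁; inj₂)
open import Data.Empty using (⊥-elim)
open import Function using (_∘_)
open import Relation.Nullary using (¬_; yes; no)
open import Relation.Binary.PropositionalEquality

-- Unlike Asymmetric, the vertices are explicit: unification cannot recover them from a circulant arc.
Oriented : ∀ {m} → Rel m → Set
Oriented A = ∀ x y → A x y → ¬ A y x

TwoPath : ∀ {m} → Rel m → Fin m → Fin m → Set
TwoPath A a b = ∃ λ c → A a c × A c b

ArcOrTwoPath : ∀ {m} → Rel m → Fin m → Fin m → Set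
ArcOrTwoPath A a b = A a b ⊎ A b a ⊎ TwoPath A a b ⊎ TwoPath A b a

twoPath-colours≢ : ∀ {m k} {A : Rel m} {φ : Fin m → Fin k} → IsOrientedColouring A k φ →
  ∀ {a b} → TwoPath A a b → φ a ≢ φ b
twoPath-colours≢ (_ , φ-ii) (_ , ap , pb) φa≡φb = φ-ii _ _ _ _ ap pb φa≡φb refl

module _ {M} (A : Rel (suc M)) (oriented : Oriented A) {a b : Fin (suc M)} (a≢b : a ≢ b)
  (far : ¬ ArcOrTwoPath A a b) where

  private
    identify : Fin (suc M) → Fin (suc M)
    identify v with v ≟ᶠ b
    ... | yes _ = a
    ... | no _ = v

    identify≢b : ∀ v → identify v ≢ b
    identify≢b v with v ≟ᶠ b
    ... | yes _ = a≢b
    ... | no v≢b = v≢b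

    ψ : Fin (suc M) → Fin M
    ψ v = punchOut (identify≢b v ∘ sym)

    Identified : Fin (suc M) → Fin (suc M) → Set
    Identified u v = u ≡ v ⊎ (u ≡ a × v ≡ b) ⊎ (u ≡ b × v ≡ a)

    identify-inv : ∀ u v → identify u ≡ identify v → Identified u v
    identify-inv u v e with u ≟ᶠ b | v ≟ᶠ b
    ... | yes u≡b | yes v≡b = inj₁ (trans u≡b (sym v≡b))
    ... | yes u≡b | no _    = inj₂ (inj₂ (u≡b , sym e))
    ... | no _    | yes v≡b = inj₂ (inj₁ (e , v≡b))
    ... | no _    | no _    = inj₁ e

    ψ-inv : ∀ u v → ψ u ≡ ψ v → Identified u v
    ψ-inv u v e = identify-inv u v (punchOut-injective (identify≢b u ∘ sym) (identify≢b v ∘ sym) e)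

    loopless : ∀ v → ¬ A v v
    loopless v vv = oriented v v vv vv

    ψ-i : ∀ x y → A x y → ψ x ≢ ψ y
    ψ-i x y xy e with ψ-inv x y e
    ... | inj₁ refl                  = loopless x xy
    ... | inj₂ (inj₁ (refl , refl)) = far (inj₁ xy)
    ... | inj₂ (inj₂ (refl , refl)) = far (inj₂ (inj₁ xy))

    ψ-ii : ∀ p q r s → A p q → A r s → ψ p ≡ ψ s → ψ q ≢ ψ r
    ψ-ii p q r s pq rs e₁ e₂ with ψ-inv p s e₁ | ψ-inv q r e₂
    ... | inj₁ refl                 | inj₁ refl                 = oriented p q pq rs
    ... | inj₁ refl                 | inj₂ (inj₁ (refl , refl)) = far (inj₂ (inj₂ (inj₂ (p , rs , pq))))
    ... | inj₁ refl                 | inj₂ (inj₂ (refl , refl)) = far (inj₂ (inj₂ (inj₁ (p , rs , pq))))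
    ... | inj₂ (inj₁ (refl , refl)) | inj₁ refl                 = far (inj₂ (inj₂ (inj₁ (q , pq , rs))))
    ... | inj₂ (inj₂ (refl , refl)) | inj₁ refl                 = far (inj₂ (inj₂ (inj₂ (q , pq , rs))))
    ... | inj₂ (inj₁ (refl , refl)) | inj₂ (inj₁ (refl , refl)) = loopless p pq
    ... | inj₂ (inj₁ (refl , refl)) | inj₂ (inj₂ (refl , refl)) = far (inj₁ pq)
    ... | inj₂ (inj₂ (refl , refl)) | inj₂ (inj₁ (refl , refl)) = far (inj₂ (inj₁ pq))
    ... | inj₂ (inj₂ (refl , refl)) | inj₂ (inj₂ (refl , refl)) = loopless p pq

  identifyFarPair-colouring : HasOrientedColouring A M
  identifyFarPair-colouring = ψ , ψ-i , ψ-ii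

module _ {m k} (A : Rel m) (oriented : Oriented A) {x y : Fin m} {φ : Fin m → Fin k}
  (φ-col : IsOrientedColouring (deleteArc A x y) k φ)
  (inNeighbours-avoid : ∀ c → A c x → φ c ≢ φ y) where

  private
    ψ : Fin m → Fin (suc k)
    ψ v with v ≟ᶠ x
    ... | yes _ = fromℕ k
    ... | no _  = inject₁ (φ v)

    SameColour : Fin m → Fin m → Set
    SameColour u v = (u ≡ x × v ≡ x) ⊎ (u ≢ x × v ≢ x × φ u ≡ φ v)

    ψ-inv : ∀ u v → ψ u ≡ ψ v → SameColour u v
    ψ-inv u v e with u ≟ᶠ x | v ≟ᶠ x
    ... | yes u≡x | yes v≡x = inj₁ (u≡x , v≡x)
    ... | yes _   | no _    = ⊥-elim (fromℕ≢inject₁ e)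
    ... | no _    | yes _   = ⊥-elim (fromℕ≢inject₁ (sym e))
    ... | no u≢x  | no v≢x  = inj₂ (u≢x , v≢x , inject₁-injective e)

    kept : ∀ {u v} → A u v → u ≢ x ⊎ v ≢ y → deleteArc A x y u v
    kept uv (inj₁ u≢x) = uv , u≢x ∘ proj₁
    kept uv (inj₂ v≢y) = uv , v≢y ∘ proj₂

    ψ-i : ∀ a b → A a b → ψ a ≢ ψ b
    ψ-i a b ab e with ψ-inv a b e
    ... | inj₁ (refl , refl)   = oriented a a ab ab
    ... | inj₂ (a≢x , _ , φe) = proj₁ φ-col a b (kept ab (inj₁ a≢x)) φe

    through-x : ∀ {c d} → A c x → A x d → φ c ≢ φ d
    through-x {c} {d} cx xd with d ≟ᶠ y
    ... | yes refl = inNeighbours-avoid c cx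
    ... | no d≢y   = twoPath-colours≢ φ-col (x , kept cx (inj₁ λ { refl → oriented x x cx cx }) , kept xd (inj₂ d≢y))

    ψ-ii : ∀ a b c d → A a b → A c d → ψ a ≡ ψ d → ψ b ≢ ψ c
    ψ-ii a b c d ab cd e₁ e₂ with ψ-inv a d e₁ | ψ-inv b c e₂
    ... | inj₁ (refl , refl)        | inj₁ (refl , refl)        = oriented a a ab ab
    ... | inj₁ (refl , refl)        | inj₂ (_ , _ , φb≡φc)      = through-x cd ab (sym φb≡φc)
    ... | inj₂ (_ , _ , φa≡φd)      | inj₁ (refl , refl)        = through-x ab cd φa≡φd
    ... | inj₂ (a≢x , _ , φa≡φd)    | inj₂ (_ , c≢x , φb≡φc)    =
      proj₂ φ-col a b c d (kept ab (inj₁ a≢x)) (kept cd (inj₁ c≢x)) φa≡φd φb≡φc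

  freshTail-colouring : HasOrientedColouring A (suc k)
  freshTail-colouring = ψ , ψ-i , ψ-ii

module ℤ/1+ (n : ℕ) where

  private
    N : ℕ
    N = suc n

  infixl 6 _⊕_
  _⊕_ : Fin N → Fin N → Fin N
  i ⊕ j = (toℕ i + toℕ j) mod N

  toℕ-mod : ∀ m → toℕ (m mod N) ≡ m % N
  toℕ-mod m = toℕ-fromℕ< (m%n<n m N)

  toℕ-⊕ : ∀ i j → toℕ (i ⊕ j) ≡ (toℕ i + toℕ j) % N
  toℕ-⊕ i j = toℕ-mod (toℕ i + toℕ j)

  toℕ%N : ∀ (i : Fin N) → toℕ i % N ≡ toℕ i
  toℕ%N i = m<n⇒m%n≡m (toℕ<n i)

  %-absorbˡ : ∀ a b → (a % N + b) % N ≡ (a + b) % N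
  %-absorbˡ a b = begin
    (a % N + b) % N         ≡⟨ %-distribˡ-+ (a % N) b N ⟩
    (a % N % N + b % N) % N ≡⟨ cong (λ x → (x + b % N) % N) (m%n%n≡m%n a N) ⟩
    (a % N + b % N) % N     ≡⟨ %-distribˡ-+ a b N ⟨
    (a + b) % N             ∎
    where open ≡-Reasoning

  %-absorbʳ : ∀ a b → (a + b % N) % N ≡ (a + b) % N
  %-absorbʳ a b = begin
    (a + b % N) % N ≡⟨ cong (_% N) (+-comm a (b % N)) ⟩
    (b % N + a) % N ≡⟨ %-absorbˡ b a ⟩
    (b + a) % N     ≡⟨ cong (_% N) (+-comm b a) ⟩
    (a + b) % N     ∎
    where open ≡-Reasoning

  ⊕-assoc : ∀ i j k → (i ⊕ j) ⊕ k ≡ i ⊕ (j ⊕ k)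
  ⊕-assoc i j k = toℕ-injective (begin
    toℕ (i ⊕ j ⊕ k)                        ≡⟨ toℕ-⊕ (i ⊕ j) k ⟩
    (toℕ (i ⊕ j) + toℕ k) % N              ≡⟨ cong (λ x → (x + toℕ k) % N) (toℕ-⊕ i j) ⟩
    ((toℕ i + toℕ j) % N + toℕ k) % N      ≡⟨ %-absorbˡ (toℕ i + toℕ j) (toℕ k) ⟩
    (toℕ i + toℕ j + toℕ k) % N            ≡⟨ cong (_% N) (+-assoc (toℕ i) (toℕ j) (toℕ k)) ⟩
    (toℕ i + (toℕ j + toℕ k)) % N          ≡⟨ %-absorbʳ (toℕ i) (toℕ j + toℕ k) ⟨
    (toℕ i + (toℕ j + toℕ k) % N) % N      ≡⟨ cong (λ x → (toℕ i + x) % N) (toℕ-⊕ j k) ⟨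
    (toℕ i + toℕ (j ⊕ k)) % N              ≡⟨ toℕ-⊕ i (j ⊕ k) ⟨
    toℕ (i ⊕ (j ⊕ k))                      ∎)
    where open ≡-Reasoning

  ⊕-comm : ∀ i j → i ⊕ j ≡ j ⊕ i
  ⊕-comm i j = cong (_mod N) (+-comm (toℕ i) (toℕ j))

  ⊕-identityʳ : ∀ i → i ⊕ zero ≡ i
  ⊕-identityʳ i = toℕ-injective (begin
    toℕ (i ⊕ zero)     ≡⟨ toℕ-⊕ i zero ⟩
    (toℕ i + 0) % N    ≡⟨ cong (_% N) (+-identityʳ (toℕ i)) ⟩
    toℕ i % N          ≡⟨ toℕ%N i ⟩
    toℕ i              ∎)
    where open ≡-Reasoning

  ⊕-identityˡ : ∀ i → zero ⊕ i ≡ i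
  ⊕-identityˡ i = trans (⊕-comm zero i) (⊕-identityʳ i)

  ⊕-diffZ : ∀ i j → i ⊕ diffZ N i j ≡ j
  ⊕-diffZ i j = toℕ-injective (begin
    toℕ (i ⊕ diffZ N i j)                  ≡⟨ toℕ-⊕ i (diffZ N i j) ⟩
    (toℕ i + toℕ (diffZ N i j)) % N        ≡⟨ cong (λ x → (toℕ i + x) % N) (toℕ-mod (N + toℕ j ∸ toℕ i)) ⟩
    (toℕ i + (N + toℕ j ∸ toℕ i) % N) % N  ≡⟨ %-absorbʳ (toℕ i) _ ⟩
    (toℕ i + (N + toℕ j ∸ toℕ i)) % N      ≡⟨ cong (_% N) (m+[n∸m]≡n i≤N+j) ⟩
    (N + toℕ j) % N                        ≡⟨ cong (_% N) (+-comm N (toℕ j)) ⟩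
    (toℕ j + N) % N                        ≡⟨ [m+n]%n≡m%n (toℕ j) N ⟩
    toℕ j % N                              ≡⟨ toℕ%N j ⟩
    toℕ j                                  ∎)
    where
    open ≡-Reasoning
    i≤N+j : toℕ i ≤ N + toℕ j
    i≤N+j = ≤-trans (<⇒≤ (toℕ<n i)) (m≤m+n N (toℕ j))

  ⊕-negZ : ∀ i → i ⊕ negZ N i ≡ zero
  ⊕-negZ i = toℕ-injective (begin
    toℕ (i ⊕ negZ N i)             ≡⟨ toℕ-⊕ i (negZ N i) ⟩
    (toℕ i + toℕ (negZ N i)) % N   ≡⟨ cong (λ x → (toℕ i + x) % N) (toℕ-mod (N ∸ toℕ i)) ⟩
    (toℕ i + (N ∸ toℕ i) % N) % N  ≡⟨ %-absorbʳ (toℕ i) _ ⟩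
    (toℕ i + (N ∸ toℕ i)) % N      ≡⟨ cong (_% N) (m+[n∸m]≡n (<⇒≤ (toℕ<n i))) ⟩
    N % N                          ≡⟨ n%n≡0 N ⟩
    0                              ∎)
    where open ≡-Reasoning

  isAbelianGroup : IsAbelianGroup _≡_ _⊕_ zero (negZ N)
  isAbelianGroup = record
    { isGroup = record
      { isMonoid = record
        { isSemigroup = record
          { isMagma = record { isEquivalence = isEquivalence ; ∙-cong = cong₂ _⊕_ }
          ; assoc = ⊕-assoc
          }
        ; identity = ⊕-identityˡ , ⊕-identityʳ
        }
      ; inverse = (λ i → trans (⊕-comm (negZ N i) i) (⊕-negZ i)) , ⊕-negZ
      ; ⁻¹-cong = cong (negZ N)
      }
    ; comm = ⊕-comm
    }

  abelianGroup : AbelianGroup _ _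
  abelianGroup = record { isAbelianGroup = isAbelianGroup }

  open AbelianGroupProperties abelianGroup public using (∙-cancelˡ; inverseʳ-unique)

  diffZ-unique : ∀ i d {j} → i ⊕ d ≡ j → diffZ N i j ≡ d
  diffZ-unique i d {j} i⊕d≡j = ∙-cancelˡ i (diffZ N i j) d (trans (⊕-diffZ i j) (sym i⊕d≡j))

  IsInvolution : Fin N → Set
  IsInvolution h = h ≢ zero × h ⊕ h ≡ zero

  even⇒involution : 2 ∣ N → ∃ IsInvolution
  even⇒involution (divides zero ())
  even⇒involution (divides q@(suc _) N≡2q) = h , h≢0 , toℕ-injective h⊕h≡0
    where
    q<N : q < N
    q<N = subst (q <_) (sym N≡2q) (m<m*n q 2 (s≤s (s≤s z≤n)))
    h : Fin N
    h = fromℕ< q<N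
    h≢0 : h ≢ zero
    h≢0 h≡0 with trans (sym (toℕ-fromℕ< q<N)) (cong toℕ h≡0)
    ... | ()
    h⊕h≡0 : toℕ (h ⊕ h) ≡ 0
    h⊕h≡0 = begin
      toℕ (h ⊕ h)         ≡⟨ toℕ-⊕ h h ⟩
      (toℕ h + toℕ h) % N ≡⟨ cong (λ x → (x + x) % N) (toℕ-fromℕ< q<N) ⟩
      (q + q) % N         ≡⟨ cong (λ x → (q + x) % N) (+-identityʳ q) ⟨
      (2 * q) % N         ≡⟨ cong (_% N) (trans (*-comm 2 q) (sym N≡2q)) ⟩
      N % N               ≡⟨ n%n≡0 N ⟩
      0                   ∎
      where open ≡-Reasoning

module _ {n : ℕ} (S : Subset (suc n)) (admissible : Admissible (suc n) S) where

  open ℤ/1+ n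
  open CommutativeMonoidSolver (AbelianGroup.commutativeMonoid abelianGroup)
    using (solve; _⊜_) renaming (_⊕_ to _∙_)

  private
    N : ℕ
    N = suc n
    G : Rel N
    G = Circulant N S

  arc : ∀ i d {j} → i ⊕ d ≡ j → d ∈ S → G i j
  arc i d i⊕d≡j d∈S = subst (_∈ S) (sym (diffZ-unique i d i⊕d≡j)) d∈S

  circulant-oriented : Oriented G
  circulant-oriented i j ij ji = admissible d₁ ij (subst (_∈ S) (inverseʳ-unique d₁ d₂ d₁⊕d₂≡0) ji)
    where
    d₁ d₂ : Fin N
    d₁ = diffZ N i j
    d₂ = diffZ N j i
    d₁⊕d₂≡0 : d₁ ⊕ d₂ ≡ zero
    d₁⊕d₂≡0 = ∙-cancelˡ i _ _ (begin
      i ⊕ (d₁ ⊕ d₂) ≡⟨ ⊕-assoc i d₁ d₂ ⟨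
      i ⊕ d₁ ⊕ d₂   ≡⟨ cong (_⊕ d₂) (⊕-diffZ i j) ⟩
      j ⊕ d₂        ≡⟨ ⊕-diffZ j i ⟩
      i             ≡⟨ ⊕-identityʳ i ⟨
      i ⊕ zero      ∎)
      where open ≡-Reasoning

  selfInverse-noArc : ∀ h i {j} → h ⊕ h ≡ zero → i ⊕ h ≡ j → ¬ G i j
  selfInverse-noArc h i h⊕h≡0 i⊕h≡j ij = admissible h h∈S (subst (_∈ S) (inverseʳ-unique h h h⊕h≡0) h∈S)
    where
    h∈S : h ∈ S
    h∈S = subst (_∈ S) (diffZ-unique i h i⊕h≡j) ij

  inNeighbour→head-twoPath : ∀ c m {w} → G c m → G m w → diffZ N c m ≢ diffZ N m w →
    TwoPath (deleteArc G m w) c w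
  inNeighbour→head-twoPath c m {w} cm mw r≢s = p , (cp , c≢m ∘ proj₁) , (pw , p≢m ∘ proj₁)
    where
    s r p : Fin N
    s = diffZ N m w
    r = diffZ N c m
    p = c ⊕ s
    cp : G c p
    cp = arc c s refl mw
    pw : G p w
    pw = arc p r (begin
      c ⊕ s ⊕ r ≡⟨ solve 3 (λ c s r → (c ∙ s) ∙ r ⊜ (c ∙ r) ∙ s) refl c s r ⟩
      c ⊕ r ⊕ s ≡⟨ cong (_⊕ s) (⊕-diffZ c m) ⟩
      m ⊕ s     ≡⟨ ⊕-diffZ m w ⟩
      w         ∎) cm
      where open ≡-Reasoning
    c≢m : c ≢ m
    c≢m refl = circulant-oriented m m cm cm
    p≢m : p ≢ m
    p≢m p≡m = r≢s (diffZ-unique c s p≡m)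

  head→inNeighbour-twoPath : ∀ h u m {w} c → h ⊕ h ≡ zero → u ⊕ h ≡ w → G u m → G m w → G c m →
    diffZ N c m ≡ diffZ N m w → TwoPath (deleteArc G m w) w c
  head→inNeighbour-twoPath h u m {w} c h⊕h≡0 u⊕h≡w um mw cm r≡s = p , (wp , w≢m ∘ proj₁) , (pc , c≢w ∘ proj₂)
    where
    s t p : Fin N
    s = diffZ N m w
    t = diffZ N u m
    p = w ⊕ t
    c⊕s≡m : c ⊕ s ≡ m
    c⊕s≡m = subst (λ d → c ⊕ d ≡ m) r≡s (⊕-diffZ c m)
    t⊕s≡h : t ⊕ s ≡ h
    t⊕s≡h = ∙-cancelˡ u _ _ (begin
      u ⊕ (t ⊕ s) ≡⟨ ⊕-assoc u t s ⟨
      u ⊕ t ⊕ s   ≡⟨ cong (_⊕ s) (⊕-diffZ u m) ⟩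
      m ⊕ s       ≡⟨ ⊕-diffZ m w ⟩
      w           ≡⟨ u⊕h≡w ⟨
      u ⊕ h       ∎)
      where open ≡-Reasoning
    wp : G w p
    wp = arc w t refl um
    pc : G p c
    pc = arc p t (begin
      w ⊕ t ⊕ t                 ≡⟨ cong (λ x → x ⊕ t ⊕ t) (trans (sym (⊕-diffZ m w)) (cong (_⊕ s) (sym c⊕s≡m))) ⟩
      c ⊕ s ⊕ s ⊕ t ⊕ t         ≡⟨ solve 3 (λ c s t → (((c ∙ s) ∙ s) ∙ t) ∙ t ⊜ c ∙ ((t ∙ s) ∙ (t ∙ s))) refl c s t ⟩
      c ⊕ ((t ⊕ s) ⊕ (t ⊕ s))   ≡⟨ cong (λ x → c ⊕ (x ⊕ x)) t⊕s≡h ⟩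
      c ⊕ (h ⊕ h)               ≡⟨ cong (c ⊕_) h⊕h≡0 ⟩
      c ⊕ zero                  ≡⟨ ⊕-identityʳ c ⟩
      c                         ∎) um
      where open ≡-Reasoning
    w≢m : w ≢ m
    w≢m refl = circulant-oriented m m mw mw
    c≢w : c ≢ w
    c≢w refl = circulant-oriented m w mw cm

  selfInverseTwoPath-inNeighbours-avoid : ∀ h u m {w} → h ⊕ h ≡ zero → u ⊕ h ≡ w → G u m → G m w →
    ∀ {k} {φ : Fin N → Fin k} → IsOrientedColouring (deleteArc G m w) k φ →
    ∀ c → G c m → φ c ≢ φ w
  selfInverseTwoPath-inNeighbours-avoid h u m {w} h⊕h≡0 u⊕h≡w um mw φ-col c cm
    with diffZ N c m ≟ᶠ diffZ N m w
  ... | no r≢s  = twoPath-colours≢ φ-col (inNeighbour→head-twoPath c m cm mw r≢s)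
  ... | yes r≡s = twoPath-colours≢ φ-col (head→inNeighbour-twoPath h u m c h⊕h≡0 u⊕h≡w um mw cm r≡s) ∘ sym

involution⇒¬deeplyCriticalClique : ∀ {k} (S : Subset (suc (suc k))) → Admissible (suc (suc k)) S →
  ∀ {h} → ℤ/1+.IsInvolution (suc k) h →
  ¬ (IsAbsoluteClique (Circulant (suc (suc k)) S) × IsDeeplyCritical (Circulant (suc (suc k)) S))
involution⇒¬deeplyCriticalClique {k} S admissible {h} (h≢0 , h⊕h≡0) (clique , deeplyCritical) =
  uncolourable (identifyFarPair-colouring G oriented (h≢0 ∘ sym) far)
  where
  open ℤ/1+ (suc k)
  G : Rel (suc (suc k))
  G = Circulant (suc (suc k)) S

  oriented : Oriented G
  oriented = circulant-oriented S admissible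

  uncolourable : ¬ HasOrientedColouring G (suc k)
  uncolourable = proj₂ clique (suc k) ≤-refl

  noTwoPathSpanning-h : ∀ u {w} → u ⊕ h ≡ w → ¬ TwoPath G u w
  noTwoPathSpanning-h u {w} u⊕h≡w (m , um , mw) with deeplyCritical (suc (suc k)) clique m w mw
  ... | (_ , φ-col) , _ = uncolourable (freshTail-colouring G oriented φ-col
    (selfInverseTwoPath-inNeighbours-avoid S admissible h u m h⊕h≡0 u⊕h≡w um mw φ-col))

  far : ¬ ArcOrTwoPath G zero h
  far (inj₁ 0h)              = selfInverse-noArc S admissible h zero h⊕h≡0 (⊕-identityˡ h) 0h
  far (inj₂ (inj₁ h0))       = selfInverse-noArc S admissible h h h⊕h≡0 h⊕h≡0 h0
  far (inj₂ (inj₂ (inj₁ p))) = noTwoPathSpanning-h zero (⊕-identityˡ h) p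
  far (inj₂ (inj₂ (inj₂ p))) = noTwoPathSpanning-h h h⊕h≡0 p

theorem4 : (n : ℕ) .{{_ : NonZero n}} → 2 ∣ n → (S : Subset n) → Admissible n S →
    ¬ (IsAbsoluteClique (Circulant n S) × IsDeeplyCritical (Circulant n S))
theorem4 (suc zero) 2∣1 _ _ _ with ∣1⇒≡1 2∣1
... | ()
theorem4 (suc (suc k)) 2∣n S admissible =
  involution⇒¬deeplyCriticalClique S admissible (proj₂ (ℤ/1+.even⇒involution (suc k) 2∣n))
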